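{- Let $G$ be a graph with root $r$ and $p(r)=0$, and let $T$ be a rooted subtree of $G$ of maximum density $d^*$. Then (i) every branch of $T$ at $r$ has density $d^*$; (ii) if $T$ is a min-max subtree of $G$, then $T$ has only one branch at $r$.
   Context: $G=(V,E)$ is a finite undirected graph with edge costs $c(e)>0$, vertex prizes $p(v)\ge0$, and root $r$. For a subgraph $S$, $p(S)$ and $c(S)$ denote the sum of vertex prizes and of edge costs. A rooted subtree is a subtree of $G$ containing $r$; for one with at least one edge $d(T)=p(T)/c(T)$, and the trivial tree $(\{r\},\emptyset)$ has density $0$; $d^*$ is the maximum density over all rooted subtrees. A min-max subtree is an inclusion-wise minimal rooted subtree of maximum density. A branch of $T$ at $r$ is, for an edge $e$ of $T$ incident to $r$, the subtree of $T$ induced by $r$ and all vertices $u$ of $T$ whose $r$-$u$ path in $T$ contains $e$.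
   Formalization: The edge costs $c(e)$ and vertex prizes $p(v)$ take values in the rationals instead of the reals. -}

module Defs where

open import Data.Nat using (ℕ; zero; suc; _<ᵇ_; _≤_)
open import Data.Fin using (Fin; toℕ)
import Data.Fin as F
open import Data.Bool using (Bool; true; false; if_then_else_; _∧_)
open import Data.List using (List; []; _∷_; _++_; [_]; head; last; length)
open import Data.List.Relation.Unary.All using (All)
open import Data.List.Relation.Unary.Unique.Propositional using (Unique)
open import Data.Maybe using (just)
open import Data.Product using (_×_; ∃; ∃-syntax)
open import Data.Sum using (_⊎_)
open import Data.Empty using (⊥)
open import Data.Unit using (⊤)
open import Relation.Nullary using (¬_; yes; no)
open import Relation.Binary.PropositionalEquality using (_≡_)
open import Data.Rational using (ℚ; 0ℚ; _+_; _÷_; ≢-nonZero) renaming (_≤_ to _≤ℚ_; _<_ to _<ℚ_)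
open import Data.Rational.Properties using (_≟_)

record Graph (n : ℕ) : Set where
  field
    adj      : Fin n → Fin n → Bool
    adj-sym  : ∀ u v → adj u v ≡ adj v u
    adj-irr  : ∀ u → adj u u ≡ false
    cost     : Fin n → Fin n → ℚ
    cost-sym : ∀ u v → cost u v ≡ cost v u
    cost-pos : ∀ u v → adj u v ≡ true → 0ℚ <ℚ cost u v
    prize    : Fin n → ℚ
    prize-nn : ∀ u → 0ℚ ≤ℚ prize u
    root     : Fin n

record Subgraph (n : ℕ) : Set where
  constructor mkSub
  field
    V : Fin n → Bool
    E : Fin n → Fin n → Bool

open Graph public
open Subgraph public

IsSubgraph : ∀ {n} → Graph n → Subgraph n → Set
IsSubgraph G S =
  (∀ u v → E S u v ≡ E S v u) ×
  (∀ u v → E S u v ≡ true → adj G u v ≡ true) ×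
  (∀ u v → E S u v ≡ true → V S u ≡ true × V S v ≡ true)

sumFin : ∀ {n} → (Fin n → ℚ) → ℚ
sumFin {zero}  f = 0ℚ
sumFin {suc n} f = f F.zero + sumFin (λ i → f (F.suc i))

prizeOf : ∀ {n} → Graph n → Subgraph n → ℚ
prizeOf G S = sumFin (λ u → if V S u then prize G u else 0ℚ)

-- c(S): total cost of edges of S (each unordered edge {u,v} counted once, via u < v)
costOf : ∀ {n} → Graph n → Subgraph n → ℚ
costOf G S = sumFin (λ u → sumFin (λ v →
  if (E S u v ∧ (toℕ u <ᵇ toℕ v)) then cost G u v else 0ℚ))

-- d(S) = p(S)/c(S) if S has an edge (then c(S) > 0), and 0 for an edgeless S
density : ∀ {n} → Graph n → Subgraph n → ℚ
density G S with costOf G S ≟ 0ℚ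
... | yes _  = 0ℚ
... | no c≢0 = _÷_ (prizeOf G S) (costOf G S) {{≢-nonZero c≢0}}

Chain : ∀ {n} → Subgraph n → List (Fin n) → Set
Chain S []           = ⊤
Chain S (x ∷ [])     = ⊤
Chain S (x ∷ y ∷ xs) = E S x y ≡ true × Chain S (y ∷ xs)

IsPath : ∀ {n} → Subgraph n → Fin n → Fin n → List (Fin n) → Set
IsPath S u v xs =
  Chain S xs × Unique xs × All (λ x → V S x ≡ true) xs ×
  head xs ≡ just u × last xs ≡ just v

Connected : ∀ {n} → Subgraph n → Set
Connected S = ∀ u v → V S u ≡ true → V S v ≡ true → ∃[ xs ] IsPath S u v xs

HasCycle : ∀ {n} → Subgraph n → Set
HasCycle S = ∃[ u ] ∃[ ys ]
  (2 ≤ length ys × Unique (u ∷ ys) × Chain S (u ∷ ys ++ [ u ]))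

IsTree : ∀ {n} → Graph n → Subgraph n → Set
IsTree G S = IsSubgraph G S × Connected S × ¬ HasCycle S

IsRootedSubtree : ∀ {n} → Graph n → Subgraph n → Set
IsRootedSubtree G S = IsTree G S × V S (root G) ≡ true

IsMaxDensity : ∀ {n} → Graph n → Subgraph n → Set
IsMaxDensity G T =
  IsRootedSubtree G T × (∀ T' → IsRootedSubtree G T' → density G T' ≤ℚ density G T)

_⊆ₛ_ : ∀ {n} → Subgraph n → Subgraph n → Set
S ⊆ₛ T = (∀ u → V S u ≡ true → V T u ≡ true) × (∀ u v → E S u v ≡ true → E T u v ≡ true)

_≡ₛ_ : ∀ {n} → Subgraph n → Subgraph n → Set
S ≡ₛ T = (∀ u → V S u ≡ V T u) × (∀ u v → E S u v ≡ E T u v)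

IsMinMax : ∀ {n} → Graph n → Subgraph n → Set
IsMinMax G T = IsMaxDensity G T × (∀ T' → IsMaxDensity G T' → T' ⊆ₛ T → T' ≡ₛ T)

IsBranch : ∀ {n} → Graph n → Subgraph n → Fin n → Subgraph n → Set
IsBranch G T w B =
  E T (root G) w ≡ true ×
  (∀ u → V B u ≡ true → (u ≡ root G ⊎ ∃[ xs ] IsPath T (root G) u (root G ∷ w ∷ xs))) ×
  (∀ u → (u ≡ root G ⊎ ∃[ xs ] IsPath T (root G) u (root G ∷ w ∷ xs)) → V B u ≡ true) ×
  (∀ u v → E B u v ≡ (E T u v ∧ V B u ∧ V B v))

-- Removing the non-root vertices of a branch B from T leaves a rooted subtree C. The only edges
-- between B and the rest of T meet r, and p(r) = 0, so the prize and the cost of T are the sums of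
-- those of B and C. Both parts satisfy p ≤ d*·c while T attains equality, hence so does B: d(B) = d*.
-- For (ii), a branch B at w₁ of a min-max T has density d*, so minimality forces B = T; a second
-- root neighbour w₂ ≠ w₁ then lies in B, and the path r, w₁, …, w₂ closed by the edge w₂ r is a cycle.

module Submission where

open import Defs
open import Data.Nat using (ℕ; zero; suc; s≤s; z≤n; _<ᵇ_) renaming (_<_ to _<ℕ_)
import Data.Nat.Properties as ℕ
open import Data.Fin as Fin using (Fin; toℕ)
import Data.Fin.Properties as Fin
open import Data.Bool using (Bool; true; false; if_then_else_; _∧_; _∨_; not)
open import Data.Bool.Properties
  using (∧-conicalˡ; ∧-conicalʳ; ∧-comm; ∧-distribʳ-∨; ∨-zeroʳ; ¬-not; not-injective)
open import Data.List using (List; []; _∷_; _++_; [_]; head; last)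
import Data.List.Properties as List
open import Data.List.Relation.Unary.All as All using (All; []; _∷_)
import Data.List.Relation.Unary.All.Properties as All
open import Data.List.Relation.Unary.Any using (here; there; any?)
open import Data.List.Relation.Unary.AllPairs using ([]; _∷_)
open import Data.List.Membership.Propositional using (_∈_)
open import Data.List.Membership.Propositional.Properties using (∈-∃++)
open import Data.List.Relation.Unary.Unique.Propositional using (Unique)
import Data.List.Relation.Unary.Unique.Propositional.Properties as Unique
open import Data.Maybe using (just)
open import Data.Maybe.Properties using (just-injective)
open import Data.Product using (_×_; _,_; ∃-syntax; proj₁; proj₂; uncurry)
open import Data.Sum using (_⊎_; inj₁; inj₂)
open import Data.Empty using (⊥; ⊥-elim)
open import Data.Unit using (tt)
open import Data.Rational
  using (ℚ; 0ℚ; 1ℚ; _+_; _*_; _÷_; 1/_; _≤_; _<_; NonZero; NonNegative; ≢-nonZero; nonNegative)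
open import Data.Rational.Properties as ℚ using (_≟_)
open import Algebra.Bundles using (CommutativeMonoid)
open import Algebra.Properties.CommutativeSemigroup
  (CommutativeMonoid.commutativeSemigroup ℚ.+-0-commutativeMonoid) using (interchange)
open import Function using (_∘_; id)
open import Relation.Nullary using (¬_; Dec; yes; no; does; contradiction)
open import Relation.Nullary.Decidable using (dec-true; dec-false; decidable-stable; ¬¬-excluded-middle)
open import Relation.Binary using (tri<; tri≈; tri>)
open import Relation.Binary.PropositionalEquality hiding ([_])

private
  variable
    n : ℕ
    G : Graph n
    S T X Y : Subgraph n
    u v w x y : Fin n
    xs ys : List (Fin n)

true≢false : true ≢ false
true≢false ()

does⇒ : ∀ {A : Set} (a? : Dec A) → does a? ≡ true → A
does⇒ (yes a) _ = a

t≡b∨t∧[c∨¬b] : ∀ t b c → (b ≡ true → t ≡ true) → t ≡ b ∨ (t ∧ (c ∨ not b))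
t≡b∨t∧[c∨¬b] true  true  c _    = refl
t≡b∨t∧[c∨¬b] true  false c _    = sym (∨-zeroʳ c)
t≡b∨t∧[c∨¬b] false true  c b⇒t = contradiction (b⇒t refl) (true≢false ∘ sym)
t≡b∨t∧[c∨¬b] false false c _    = refl

e≡e∧a∧b∨e∧c∧d : ∀ e a b c d → (e ≡ true → (a ≡ true × b ≡ true) ⊎ (c ≡ true × d ≡ true)) →
                e ≡ (e ∧ a ∧ b) ∨ (e ∧ c ∧ d)
e≡e∧a∧b∨e∧c∧d false _ _ _ _ _ = refl
e≡e∧a∧b∨e∧c∧d true  a b c d side with side refl
... | inj₁ (refl , refl) = refl
... | inj₂ (refl , refl) = sym (∨-zeroʳ (a ∧ b))

¬¬-decidable : (P : Fin n → Set) → ¬ ¬ (∀ i → Dec (P i))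
¬¬-decidable {zero}  P k = k λ ()
¬¬-decidable {suc n} P k =
  ¬¬-excluded-middle λ P₀? → ¬¬-decidable (P ∘ Fin.suc) λ P₊? →
    k λ { Fin.zero → P₀? ; (Fin.suc i) → P₊? i }

sumFin-cong : {f g : Fin n → ℚ} → (∀ i → f i ≡ g i) → sumFin f ≡ sumFin g
sumFin-cong {zero}  f≗g = refl
sumFin-cong {suc n} f≗g = cong₂ _+_ (f≗g Fin.zero) (sumFin-cong (f≗g ∘ Fin.suc))

sumFin-+ : (f g : Fin n → ℚ) → sumFin (λ i → f i + g i) ≡ sumFin f + sumFin g
sumFin-+ {zero}  f g = sym (ℚ.+-identityʳ 0ℚ)
sumFin-+ {suc n} f g = trans (cong (f Fin.zero + g Fin.zero +_) (sumFin-+ (f ∘ Fin.suc) (g ∘ Fin.suc)))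
                             (interchange (f Fin.zero) (g Fin.zero) (sumFin (f ∘ Fin.suc)) (sumFin (g ∘ Fin.suc)))

sumFin-zero : {f : Fin n → ℚ} → (∀ i → f i ≡ 0ℚ) → sumFin f ≡ 0ℚ
sumFin-zero {zero}  f≗0 = refl
sumFin-zero {suc n} f≗0 = trans (cong₂ _+_ (f≗0 Fin.zero) (sumFin-zero (f≗0 ∘ Fin.suc))) (ℚ.+-identityʳ 0ℚ)

sumFin-nonneg : {f : Fin n → ℚ} → (∀ i → 0ℚ ≤ f i) → 0ℚ ≤ sumFin f
sumFin-nonneg {zero}  f≥0 = ℚ.≤-refl
sumFin-nonneg {suc n} f≥0 = ℚ.+-mono-≤ (f≥0 Fin.zero) (sumFin-nonneg (f≥0 ∘ Fin.suc))

term≤sumFin : {f : Fin n → ℚ} → (∀ i → 0ℚ ≤ f i) → ∀ j → f j ≤ sumFin f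
term≤sumFin {suc n} {f} f≥0 Fin.zero =
  ℚ.≤-trans (ℚ.≤-reflexive (sym (ℚ.+-identityʳ (f Fin.zero))))
            (ℚ.+-monoʳ-≤ (f Fin.zero) (sumFin-nonneg (f≥0 ∘ Fin.suc)))
term≤sumFin {suc n} {f} f≥0 (Fin.suc j) =
  ℚ.≤-trans (term≤sumFin (f≥0 ∘ Fin.suc) j)
            (ℚ.≤-trans (ℚ.≤-reflexive (sym (ℚ.+-identityˡ _))) (ℚ.+-monoˡ-≤ _ (f≥0 Fin.zero)))

÷-*-cancel : ∀ p c .{{_ : NonZero c}} → (p ÷ c) * c ≡ p
÷-*-cancel p c = begin
  p * 1/ c * c    ≡⟨ ℚ.*-assoc p (1/ c) c ⟩
  p * (1/ c * c)  ≡⟨ cong (p *_) (ℚ.*-inverseˡ c) ⟩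
  p * 1ℚ          ≡⟨ ℚ.*-identityʳ p ⟩
  p               ∎
  where open ≡-Reasoning

*-÷-cancel : ∀ d c .{{_ : NonZero c}} → (d * c) ÷ c ≡ d
*-÷-cancel d c = begin
  d * c * 1/ c    ≡⟨ ℚ.*-assoc d c (1/ c) ⟩
  d * (c * 1/ c)  ≡⟨ cong (d *_) (ℚ.*-inverseʳ c) ⟩
  d * 1ℚ          ≡⟨ ℚ.*-identityʳ d ⟩
  d               ∎
  where open ≡-Reasoning

mediant-tight : ∀ D pB cB pC cC → pB ≤ D * cB → pC ≤ D * cC → pB + pC ≡ D * (cB + cC) → pB ≡ D * cB
mediant-tight D pB cB pC cC pB≤ pC≤ sum≡ = ℚ.≤-antisym pB≤ (ℚ.≮⇒≥ λ pB< →
  ℚ.<⇒≢ (ℚ.+-mono-<-≤ pB< pC≤) (trans sum≡ (ℚ.*-distribˡ-+ D cB cC)))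

data Walk (S : Subgraph n) : Fin n → Fin n → List (Fin n) → Set where
  stop : ∀ {u} → V S u ≡ true → Walk S u u [ u ]
  step : ∀ {u x v xs} → V S u ≡ true → E S u x ≡ true → Walk S x v xs → Walk S u v (u ∷ xs)

walk-vertices : Walk S u v xs → All (λ z → V S z ≡ true) xs
walk-vertices (stop u∈S)       = u∈S ∷ []
walk-vertices (step u∈S _ rest) = u∈S ∷ walk-vertices rest

All-start : {P : Fin n → Set} → Walk S u v xs → All P xs → P u
All-start (stop _)     (Pu ∷ []) = Pu
All-start (step _ _ _) (Pu ∷ _)  = Pu

All-end : {P : Fin n → Set} → Walk S u v xs → All P xs → P v
All-end (stop _)        (Pv ∷ [])  = Pv
All-end (step _ _ rest) (_ ∷ Prest) = All-end rest Prest

walk-chain : Walk S u v xs → Chain S xs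
walk-chain (stop _)                   = tt
walk-chain (step _ e (stop _))        = e , tt
walk-chain (step _ e rest@(step _ _ _)) = e , walk-chain rest

walk-head : Walk S u v xs → head xs ≡ just u
walk-head (stop _)     = refl
walk-head (step _ _ _) = refl

walk-last : Walk S u v xs → last xs ≡ just v
walk-last (stop _)                  = refl
walk-last (step _ _ (stop _))       = refl
walk-last (step _ _ rest@(step _ _ _)) = walk-last rest

chain⇒walk : ∀ xs → Chain S xs → All (λ z → V S z ≡ true) xs →
             head xs ≡ just u → last xs ≡ just v → Walk S u v xs
chain⇒walk (_ ∷ [])     _          (x∈S ∷ [])  refl refl = stop x∈S
chain⇒walk (_ ∷ y ∷ xs) (e , chain) (x∈S ∷ inS) refl ends = step x∈S e (chain⇒walk (y ∷ xs) chain inS refl ends)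

path⇒walk : IsPath S u v xs → Walk S u v xs
path⇒walk (chain , _ , inS , start , end) = chain⇒walk _ chain inS start end

unique-walk⇒path : Walk S u v xs → Unique xs → IsPath S u v xs
unique-walk⇒path walk unique = walk-chain walk , unique , walk-vertices walk , walk-head walk , walk-last walk

walk-snoc : Walk S u v xs → E S v y ≡ true → V S y ≡ true → Walk S u y (xs ++ [ y ])
walk-snoc (stop u∈S)        e y∈S = step u∈S e (stop y∈S)
walk-snoc (step u∈S e′ rest) e y∈S = step u∈S e′ (walk-snoc rest e y∈S)

walk-prefix : ∀ xs → Walk S u v (xs ++ y ∷ ys) → Walk S u y (xs ++ [ y ])
walk-prefix []           (stop u∈S)       = stop u∈S
walk-prefix []           (step u∈S _ _)   = stop u∈S
walk-prefix (_ ∷ [])     (step u∈S e rest) = step u∈S e (walk-prefix [] rest)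
walk-prefix (_ ∷ x ∷ xs) (step u∈S e rest) = step u∈S e (walk-prefix (x ∷ xs) rest)

walk-suffix : Walk S u v xs → x ∈ xs → ∃[ ys ] Walk S x v ys × (Unique xs → Unique ys)
walk-suffix walk@(stop _)     (here refl) = _ , walk , id
walk-suffix walk@(step _ _ _) (here refl) = _ , walk , id
walk-suffix (step _ _ rest) (there x∈xs) =
  let ys , walk , unique = walk-suffix rest x∈xs in ys , walk , λ { (_ ∷ u) → unique u }

walk⇒unique-walk : Walk S u v xs → ∃[ ys ] Walk S u v ys × Unique ys
walk⇒unique-walk (stop u∈S) = _ , stop u∈S , [] ∷ []
walk⇒unique-walk (step {u} u∈S e rest) with walk⇒unique-walk rest
... | ys , walk , unique with any? (u Fin.≟_) ys
...   | yes u∈ys = let zs , walk′ , unique′ = walk-suffix walk u∈ys in zs , walk′ , unique′ unique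
...   | no  u∉ys = u ∷ ys , step u∈S e walk , All.¬Any⇒All¬ ys u∉ys ∷ unique

walk⇒path : Walk S u v xs → ∃[ ys ] IsPath S u v ys
walk⇒path walk = let ys , walk′ , unique = walk⇒unique-walk walk in ys , unique-walk⇒path walk′ unique

walk-++ : Walk S u v xs → Walk S v y ys → ∃[ zs ] Walk S u y zs
walk-++ (stop _)          walk = _ , walk
walk-++ (step u∈S e rest) walk = let _ , walk′ = walk-++ rest walk in _ , step u∈S e walk′

walk-reverse : (∀ a b → E S a b ≡ E S b a) → Walk S u v xs → ∃[ ys ] Walk S v u ys
walk-reverse E-sym (stop u∈S) = _ , stop u∈S
walk-reverse {u = u} E-sym (step {x = x} u∈S e rest) =
  let _ , back = walk-reverse E-sym rest in _ , walk-snoc back (trans (E-sym x u) e) u∈S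

connected-via : (∀ a b → E S a b ≡ E S b a) →
                (∀ u → V S u ≡ true → ∃[ xs ] Walk S x u xs) → Connected S
connected-via E-sym reach u v u∈S v∈S =
  let _ , x→u = reach u u∈S
      _ , x→v = reach v v∈S
      _ , u→x = walk-reverse E-sym x→u
      _ , u→v = walk-++ u→x x→v
  in walk⇒path u→v

path-prefix : ∀ xs → IsPath S u v (xs ++ y ∷ ys) → IsPath S u y (xs ++ [ y ])
path-prefix {y = y} {ys = ys} xs path@(_ , unique , _) =
  unique-walk⇒path (walk-prefix xs (path⇒walk path))
            (unique-++⁻ˡ (subst Unique (sym (List.++-assoc xs [ y ] ys)) unique))
  where
  unique-++⁻ˡ : ∀ {as bs} → Unique (as ++ bs) → Unique as
  unique-++⁻ˡ {[]}     _              = []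
  unique-++⁻ˡ {a ∷ as} (a∉ ∷ unique) = All.++⁻ˡ as a∉ ∷ unique-++⁻ˡ unique

path+edge⇒cycle : IsPath S u v (u ∷ x ∷ xs) → E S v u ≡ true → x ≢ v → HasCycle S
path+edge⇒cycle {xs = []}    (_ , _ , _ , _ , end) _ x≢v = contradiction (just-injective end) x≢v
path+edge⇒cycle {u = u} {x = x} {xs = y ∷ ys} path@(_ , unique , u∈S ∷ _ , _) vu _ =
  u , x ∷ y ∷ ys , s≤s (s≤s z≤n) , unique , walk-chain (walk-snoc (path⇒walk path) vu u∈S)

edge⇒≢ : (G : Graph n) → IsSubgraph G S → E S u v ≡ true → u ≢ v
edge⇒≢ {u = u} G (_ , S⊆G , _) uv refl = true≢false (trans (sym (S⊆G u u uv)) (adj-irr G u))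

costTerm : Graph n → Subgraph n → Fin n → Fin n → ℚ
costTerm G S u v = if E S u v ∧ (toℕ u <ᵇ toℕ v) then cost G u v else 0ℚ

costTerm-nonneg : (G : Graph n) → IsSubgraph G S → ∀ u v → 0ℚ ≤ costTerm G S u v
costTerm-nonneg {S = S} G (_ , S⊆G , _) u v with E S u v in uv | toℕ u <ᵇ toℕ v
... | true  | true  = ℚ.<⇒≤ (cost-pos G u v (S⊆G u v uv))
... | true  | false = ℚ.≤-refl
... | false | _     = ℚ.≤-refl

costOf-nonneg : (G : Graph n) → IsSubgraph G S → 0ℚ ≤ costOf G S
costOf-nonneg G S-sub = sumFin-nonneg λ u → sumFin-nonneg (costTerm-nonneg G S-sub u)

costTerm≤costOf : (G : Graph n) → IsSubgraph G S → ∀ u v → costTerm G S u v ≤ costOf G S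
costTerm≤costOf G S-sub u v =
  ℚ.≤-trans (term≤sumFin (costTerm-nonneg G S-sub u) v)
            (term≤sumFin (λ u → sumFin-nonneg (costTerm-nonneg G S-sub u)) u)

costOf-pos-ordered : (G : Graph n) → IsSubgraph G S → E S u v ≡ true → toℕ u <ℕ toℕ v → 0ℚ < costOf G S
costOf-pos-ordered {S = S} {u = u} {v = v} G S-sub@(_ , S⊆G , _) uv u<v =
  ℚ.<-≤-trans (cost-pos G u v (S⊆G u v uv))
              (ℚ.≤-trans (ℚ.≤-reflexive (sym term≡cost)) (costTerm≤costOf G S-sub u v))
  where
  term≡cost : (if E S u v ∧ (toℕ u <ᵇ toℕ v) then cost G u v else 0ℚ) ≡ cost G u v
  term≡cost rewrite uv with toℕ u <ᵇ toℕ v | ℕ.<⇒<ᵇ u<v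
  ... | true | _ = refl

costOf-pos : (G : Graph n) → IsSubgraph G S → E S u v ≡ true → 0ℚ < costOf G S
costOf-pos {u = u} {v = v} G S-sub@(S-sym , _ , _) uv with ℕ.<-cmp (toℕ u) (toℕ v)
... | tri< u<v _ _ = costOf-pos-ordered G S-sub uv u<v
... | tri≈ _ u≡v _ = contradiction (Fin.toℕ-injective u≡v) (edge⇒≢ G S-sub uv)
... | tri> _ _ v<u = costOf-pos-ordered G S-sub (trans (S-sym v u) uv) v<u

if-∨ : ∀ a b (x : ℚ) → (a ≡ true → b ≡ true → x ≡ 0ℚ) →
       (if a ∨ b then x else 0ℚ) ≡ (if a then x else 0ℚ) + (if b then x else 0ℚ)
if-∨ true  true  x x≡0 rewrite x≡0 refl refl = sym (ℚ.+-identityʳ 0ℚ)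
if-∨ true  false x _   = sym (ℚ.+-identityʳ x)
if-∨ false true  x _   = sym (ℚ.+-identityˡ x)
if-∨ false false x _   = sym (ℚ.+-identityʳ 0ℚ)

prizeOf-split : (G : Graph n) → (∀ u → V S u ≡ V X u ∨ V Y u) →
                (∀ u → V X u ≡ true → V Y u ≡ true → prize G u ≡ 0ℚ) →
                prizeOf G S ≡ prizeOf G X + prizeOf G Y
prizeOf-split {n = n} {S = S} {X = X} {Y = Y} G cover shared-prizeless =
  trans (sumFin-cong split) (sumFin-+ (prizeTerm X) (prizeTerm Y))
  where
  prizeTerm : Subgraph n → Fin n → ℚ
  prizeTerm Z u = if V Z u then prize G u else 0ℚ
  split : ∀ u → (if V S u then prize G u else 0ℚ) ≡ prizeTerm X u + prizeTerm Y u
  split u = trans (cong (λ b → if b then prize G u else 0ℚ) (cover u))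
                  (if-∨ (V X u) (V Y u) (prize G u) (shared-prizeless u))

costOf-split : (G : Graph n) → (∀ u v → E S u v ≡ E X u v ∨ E Y u v) →
               (∀ u v → E X u v ≡ true → E Y u v ≡ true → ⊥) →
               costOf G S ≡ costOf G X + costOf G Y
costOf-split {S = S} {X = X} {Y = Y} G cover disjoint =
  trans (sumFin-cong λ u → trans (sumFin-cong (split u)) (sumFin-+ (costTerm G X u) (costTerm G Y u)))
        (sumFin-+ (λ u → sumFin (costTerm G X u)) (λ u → sumFin (costTerm G Y u)))
  where
  split : ∀ u v → costTerm G S u v ≡ costTerm G X u v + costTerm G Y u v
  split u v = begin
    (if E S u v ∧ o then c else 0ℚ)                  ≡⟨ cong (λ b → if b ∧ o then c else 0ℚ) (cover u v) ⟩
    (if (E X u v ∨ E Y u v) ∧ o then c else 0ℚ)      ≡⟨ cong (λ b → if b then c else 0ℚ)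
                                                             (∧-distribʳ-∨ o (E X u v) (E Y u v)) ⟩
    (if E X u v ∧ o ∨ E Y u v ∧ o then c else 0ℚ)    ≡⟨ if-∨ (E X u v ∧ o) (E Y u v ∧ o) c (λ uv∈X uv∈Y →
                                                          ⊥-elim (disjoint u v (∧-conicalˡ _ o uv∈X)
                                                                               (∧-conicalˡ _ o uv∈Y))) ⟩
    costTerm G X u v + costTerm G Y u v               ∎
    where
    open ≡-Reasoning
    o : Bool
    o = toℕ u <ᵇ toℕ v
    c : ℚ
    c = cost G u v

density≡÷ : (G : Graph n) (S : Subgraph n) (c≢0 : costOf G S ≢ 0ℚ) →
            density G S ≡ (prizeOf G S ÷ costOf G S) {{≢-nonZero c≢0}}
density≡÷ G S c≢0 with costOf G S ≟ 0ℚ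
... | yes c≡0 = contradiction c≡0 c≢0
... | no  _   = refl

edgeless⇒root : IsRootedSubtree G S → costOf G S ≡ 0ℚ → V S u ≡ true → u ≡ root G
edgeless⇒root {G = G} {u = u} ((S-sub , S-connected , _) , r∈S) c≡0 u∈S
  with S-connected (root G) u r∈S u∈S
... | _ , path with path⇒walk path
...   | stop _     = refl
...   | step _ e _ = contradiction (sym c≡0) (ℚ.<⇒≢ (costOf-pos G S-sub e))

-- With p(r) = 0 this also covers the trivial tree, whose density is 0 by convention.
prize≡density*cost : prize G (root G) ≡ 0ℚ → IsRootedSubtree G S →
                     prizeOf G S ≡ density G S * costOf G S
prize≡density*cost {G = G} {S = S} p₀ S-rooted with costOf G S ≟ 0ℚ
... | no c≢0  = sym (÷-*-cancel (prizeOf G S) (costOf G S) {{≢-nonZero c≢0}})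
... | yes c≡0 = trans (sumFin-zero no-prize) (sym (ℚ.*-zeroˡ (costOf G S)))
  where
  no-prize : ∀ u → (if V S u then prize G u else 0ℚ) ≡ 0ℚ
  no-prize u with V S u in u∈S
  ... | false = refl
  ... | true  = subst (λ z → prize G z ≡ 0ℚ) (sym (edgeless⇒root {G = G} S-rooted c≡0 u∈S)) p₀

prize≤maxDensity*cost : prize G (root G) ≡ 0ℚ → IsMaxDensity G T → IsRootedSubtree G S →
                        prizeOf G S ≤ density G T * costOf G S
prize≤maxDensity*cost {G = G} {T = T} {S = S} p₀ (_ , T-best) S-rooted@((S-sub , _) , _) = begin
  prizeOf G S               ≡⟨ prize≡density*cost p₀ S-rooted ⟩
  density G S * costOf G S  ≤⟨ ℚ.*-monoʳ-≤-nonNeg (costOf G S) (T-best S S-rooted) ⟩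
  density G T * costOf G S  ∎
  where
  open ℚ.≤-Reasoning
  instance
    c≥0 : NonNegative (costOf G S)
    c≥0 = nonNegative (costOf-nonneg G S-sub)

summand-density≡ : prize G (root G) ≡ 0ℚ → IsMaxDensity G T →
                   IsRootedSubtree G X → IsRootedSubtree G Y →
                   prizeOf G T ≡ prizeOf G X + prizeOf G Y → costOf G T ≡ costOf G X + costOf G Y →
                   costOf G X ≢ 0ℚ → density G X ≡ density G T
summand-density≡ {G = G} {T = T} {X = X} {Y = Y}
                 p₀ T-max@(T-rooted , _) X-rooted Y-rooted prize-split cost-split cX≢0 = begin
  density G X                    ≡⟨ density≡÷ G X cX≢0 ⟩
  prizeOf G X ÷ costOf G X       ≡⟨ cong (λ p → p ÷ costOf G X) prizeX≡ ⟩
  (D * costOf G X) ÷ costOf G X  ≡⟨ *-÷-cancel D (costOf G X) ⟩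
  D                              ∎
  where
  open ≡-Reasoning
  instance
    cX≠0 : NonZero (costOf G X)
    cX≠0 = ≢-nonZero cX≢0
  D : ℚ
  D = density G T
  prizeX≡ : prizeOf G X ≡ D * costOf G X
  prizeX≡ = mediant-tight D _ _ _ _ (prize≤maxDensity*cost p₀ T-max X-rooted)
                                    (prize≤maxDensity*cost p₀ T-max Y-rooted) (begin
    prizeOf G X + prizeOf G Y      ≡⟨ prize-split ⟨
    prizeOf G T                    ≡⟨ prize≡density*cost p₀ T-rooted ⟩
    D * costOf G T                 ≡⟨ cong (D *_) cost-split ⟩
    D * (costOf G X + costOf G Y)  ∎)

IsInduced : Subgraph n → Subgraph n → Set
IsInduced S X = ∀ u v → E X u v ≡ (E S u v ∧ V X u ∧ V X v)

module Induced {S X : Subgraph n} (X-induced : IsInduced S X) where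

  edge⁻ : E X u v ≡ true → E S u v ≡ true
  edge⁻ {u} {v} uv = ∧-conicalˡ (E S u v) _ (trans (sym (X-induced u v)) uv)

  edge-ends : E X u v ≡ true → V X u ≡ true × V X v ≡ true
  edge-ends {u} {v} uv =
    let ends = ∧-conicalʳ (E S u v) _ (trans (sym (X-induced u v)) uv)
    in ∧-conicalˡ (V X u) _ ends , ∧-conicalʳ (V X u) _ ends

  edge⁺ : E S u v ≡ true → V X u ≡ true → V X v ≡ true → E X u v ≡ true
  edge⁺ {u} {v} uv u∈X v∈X rewrite X-induced u v | uv | u∈X | v∈X = refl

  E-sym : (∀ a b → E S a b ≡ E S b a) → ∀ a b → E X a b ≡ E X b a
  E-sym S-sym a b rewrite X-induced a b | X-induced b a | S-sym a b =
    cong (E S b a ∧_) (∧-comm (V X a) (V X b))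

  walk⁺ : All (λ z → V X z ≡ true) xs → Walk S u v xs → Walk X u v xs
  walk⁺ (u∈X ∷ [])  (stop _)        = stop u∈X
  walk⁺ (u∈X ∷ inX) (step _ e rest) = step u∈X (edge⁺ e u∈X (All-start rest inX)) (walk⁺ inX rest)

  chain⁻ : ∀ xs → Chain X xs → Chain S xs
  chain⁻ []           _           = tt
  chain⁻ (_ ∷ [])     _           = tt
  chain⁻ (_ ∷ y ∷ xs) (e , chain) = edge⁻ e , chain⁻ (y ∷ xs) chain

  rootedSubtree : (G : Graph n) → IsTree G S → V X (root G) ≡ true →
                  (∀ u → V X u ≡ true → ∃[ xs ] Walk S (root G) u xs × All (λ z → V X z ≡ true) xs) →
                  IsRootedSubtree G X
  rootedSubtree G ((S-sym , S⊆G , _) , _ , S-acyclic) r∈X reach =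
    ((E-sym S-sym , (λ u v → S⊆G u v ∘ edge⁻) , λ _ _ → edge-ends) ,
     connected-via (E-sym S-sym) (λ u u∈X → let xs , walk , inX = reach u u∈X in xs , walk⁺ inX walk) ,
     λ (u , ys , long , unique , cycle) → S-acyclic (u , ys , long , unique , chain⁻ _ cycle)) ,
    r∈X

BranchVertex : Graph n → Subgraph n → Fin n → Fin n → Set
BranchVertex G T w u = u ≡ root G ⊎ ∃[ xs ] IsPath T (root G) u (root G ∷ w ∷ xs)

-- Branch membership is not decidable constructively, but a branch exists up to double negation.
¬¬-branch : (G : Graph n) → E T (root G) w ≡ true → ¬ ¬ (∃[ B ] IsBranch G T w B)
¬¬-branch {T = T} {w = w} G rw k = ¬¬-decidable (BranchVertex G T w) λ inB? →
  k (mkSub (λ u → does (inB? u)) (λ u v → E T u v ∧ does (inB? u) ∧ does (inB? v)) ,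
     rw , (λ u → does⇒ (inB? u)) , (λ u → dec-true (inB? u)) , λ _ _ → refl)

module Branch {G : Graph n} {T : Subgraph n} (T-rooted : IsRootedSubtree G T)
              {w : Fin n} {B : Subgraph n} (isBranch : IsBranch G T w B) where

  r : Fin n
  r = root G

  T-tree : IsTree G T
  T-tree = proj₁ T-rooted

  T-sub : IsSubgraph G T
  T-sub = proj₁ T-tree

  T-sym : ∀ a b → E T a b ≡ E T b a
  T-sym = proj₁ T-sub

  T-ends : ∀ a b → E T a b ≡ true → V T a ≡ true × V T b ≡ true
  T-ends = proj₂ (proj₂ T-sub)

  T-connected : Connected T
  T-connected = proj₁ (proj₂ T-tree)

  T-acyclic : ¬ HasCycle T
  T-acyclic = proj₂ (proj₂ T-tree)

  r∈T : V T r ≡ true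
  r∈T = proj₂ T-rooted

  rw∈T : E T r w ≡ true
  rw∈T = proj₁ isBranch

  branch⁻ : ∀ u → V B u ≡ true → BranchVertex G T w u
  branch⁻ = proj₁ (proj₂ isBranch)

  branch⁺ : ∀ u → BranchVertex G T w u → V B u ≡ true
  branch⁺ = proj₁ (proj₂ (proj₂ isBranch))

  B-induced : IsInduced T B
  B-induced = proj₂ (proj₂ (proj₂ isBranch))

  module B-in-T = Induced {S = T} {X = B} B-induced

  r∈B : V B r ≡ true
  r∈B = branch⁺ r (inj₁ refl)

  w∈B : V B w ≡ true
  w∈B = branch⁺ w (inj₂ ([] , unique-walk⇒path {S = T} (step r∈T rw∈T (stop (proj₂ (T-ends r w rw∈T))))
                                        ((edge⇒≢ G T-sub rw∈T ∷ []) ∷ [] ∷ [])))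

  B⊆T : V B u ≡ true → V T u ≡ true
  B⊆T {u} u∈B with branch⁻ u u∈B
  ... | inj₁ refl      = r∈T
  ... | inj₂ (_ , path) = All-end (path⇒walk path) (walk-vertices (path⇒walk path))

  branch-path⊆B : IsPath T r u (r ∷ w ∷ xs) → All (λ z → V B z ≡ true) (r ∷ w ∷ xs)
  branch-path⊆B {u} {xs} path = r∈B ∷ w∈B ∷ All.tabulate λ z∈xs →
    let pre , _ , xs≡ = ∈-∃++ z∈xs
    in prefix∈B pre (subst (λ l → IsPath T r u (r ∷ w ∷ l)) xs≡ path)
    where
    prefix∈B : ∀ pre {z post} → IsPath T r u (r ∷ w ∷ pre ++ z ∷ post) → V B z ≡ true
    prefix∈B pre path = branch⁺ _ (inj₂ (pre ++ [ _ ] , path-prefix (r ∷ w ∷ pre) path))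

  branch-closed : V B u ≡ true → u ≢ r → E T u v ≡ true → V B v ≡ true
  branch-closed {u} {v} u∈B u≢r uv with V B v in v∈B?
  ... | true  = refl
  ... | false with branch⁻ u u∈B
  ...   | inj₁ u≡r         = contradiction u≡r u≢r
  ...   | inj₂ (xs , path) = trans (sym v∈B?) (branch⁺ v (inj₂ (xs ++ [ v ] , extended)))
    where
    extended : IsPath T r v (r ∷ w ∷ xs ++ [ v ])
    extended = unique-walk⇒path {S = T} (walk-snoc (path⇒walk path) uv (proj₂ (T-ends u v uv)))
                         (Unique.++⁺ (proj₁ (proj₂ path)) ([] ∷ []) λ where
                           (z∈path , here refl) →
                             true≢false (trans (sym (All.lookup (branch-path⊆B path) z∈path)) v∈B?))

  B-rooted : IsRootedSubtree G B
  B-rooted = B-in-T.rootedSubtree G T-tree r∈B reach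
    where
    reach : ∀ u → V B u ≡ true → ∃[ xs ] Walk T r u xs × All (λ z → V B z ≡ true) xs
    reach u u∈B with branch⁻ u u∈B
    ... | inj₁ refl       = [ r ] , stop r∈T , r∈B ∷ []
    ... | inj₂ (_ , path) = _ , path⇒walk path , branch-path⊆B path

  isRoot : Fin n → Bool
  isRoot u = does (u Fin.≟ r)

  inComplement : Fin n → Bool
  inComplement u = V T u ∧ (isRoot u ∨ not (V B u))

  C : Subgraph n
  C = mkSub inComplement (λ u v → E T u v ∧ inComplement u ∧ inComplement v)

  C-induced : IsInduced T C
  C-induced _ _ = refl

  module C-in-T = Induced {S = T} {X = C} C-induced

  r∈C : V C r ≡ true
  r∈C rewrite r∈T | dec-true (r Fin.≟ r) refl = refl

  outside⇒C : V T u ≡ true → V B u ≡ false → V C u ≡ true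
  outside⇒C {u} u∈T u∉B rewrite u∈T | u∉B = ∨-zeroʳ (isRoot u)

  C⇒outside : V C u ≡ true → u ≢ r → V B u ≡ false
  C⇒outside {u} u∈C u≢r =
    not-injective (subst (λ b → b ∨ not (V B u) ≡ true) (dec-false (u Fin.≟ r) u≢r)
                         (∧-conicalʳ (V T u) (isRoot u ∨ not (V B u)) u∈C))

  C⊆T : V C u ≡ true → V T u ≡ true
  C⊆T {u} = ∧-conicalˡ (V T u) _

  B∩C⇒root : V B u ≡ true → V C u ≡ true → u ≡ r
  B∩C⇒root {u} u∈B u∈C =
    decidable-stable (u Fin.≟ r) λ u≢r → true≢false (trans (sym u∈B) (C⇒outside u∈C u≢r))

  outside-walk : Walk T x u xs → All (r ≢_) xs → V B u ≡ false → All (λ z → V B z ≡ false) xs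
  outside-walk         (stop _)                 _                u∉B = u∉B ∷ []
  outside-walk {x = x} (step {xs = zs} _ e rest) (r≢x ∷ r∉rest) u∉B = x∉B ∷ rest∉B
    where
    rest∉B : All (λ z → V B z ≡ false) zs
    rest∉B = outside-walk rest r∉rest u∉B
    x∉B : V B x ≡ false
    x∉B = ¬-not λ x∈B → true≢false (trans (sym (branch-closed x∈B (r≢x ∘ sym) e)) (All-start rest rest∉B))

  C-reach : Dec (u ≡ r) → V C u ≡ true → ∃[ xs ] Walk T r u xs × All (λ z → V C z ≡ true) xs
  C-reach (yes refl) _ = [ r ] , stop r∈T , r∈C ∷ []
  C-reach {u} (no u≢r) u∈C with T-connected r u r∈T (C⊆T u∈C)
  ... | _ , path@(_ , unique , _) with path⇒walk path | unique
  ...   | stop _               | _          = contradiction refl u≢r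
  ...   | walk@(step _ _ rest) | r∉rest ∷ _ =
    _ , walk , r∈C ∷ All.zipWith (uncurry outside⇒C)
                                 (walk-vertices rest , outside-walk rest r∉rest (C⇒outside u∈C u≢r))

  C-rooted : IsRootedSubtree G C
  C-rooted = C-in-T.rootedSubtree G T-tree r∈C λ u → C-reach (u Fin.≟ r)

  vertex-cover : ∀ u → V T u ≡ V B u ∨ V C u
  vertex-cover u = t≡b∨t∧[c∨¬b] (V T u) (V B u) (isRoot u) B⊆T

  crossing⇒root : V B u ≡ true → V B v ≡ false → E T u v ≡ true → u ≡ r
  crossing⇒root {u} u∈B v∉B uv =
    decidable-stable (u Fin.≟ r) λ u≢r → true≢false (trans (sym (branch-closed u∈B u≢r uv)) v∉B)

  edge-side : E T u v ≡ true → (V B u ≡ true × V B v ≡ true) ⊎ (V C u ≡ true × V C v ≡ true)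
  edge-side {u} {v} uv = by-membership (V B u) (V B v) refl refl
    where
    u∈T : V T u ≡ true
    u∈T = proj₁ (T-ends u v uv)
    v∈T : V T v ≡ true
    v∈T = proj₂ (T-ends u v uv)
    by-membership : ∀ a b → V B u ≡ a → V B v ≡ b →
                    (V B u ≡ true × V B v ≡ true) ⊎ (V C u ≡ true × V C v ≡ true)
    by-membership true  true  u∈B v∈B = inj₁ (u∈B , v∈B)
    by-membership true  false u∈B v∉B =
      inj₂ (subst (λ z → V C z ≡ true) (sym (crossing⇒root u∈B v∉B uv)) r∈C , outside⇒C v∈T v∉B)
    by-membership false true  u∉B v∈B =
      inj₂ (outside⇒C u∈T u∉B , subst (λ z → V C z ≡ true) (sym (crossing⇒root v∈B u∉B vu)) r∈C)
      where
      vu : E T v u ≡ true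
      vu = trans (T-sym v u) uv
    by-membership false false u∉B v∉B = inj₂ (outside⇒C u∈T u∉B , outside⇒C v∈T v∉B)

  edge-cover : ∀ u v → E T u v ≡ E B u v ∨ E C u v
  edge-cover u v = trans (e≡e∧a∧b∨e∧c∧d (E T u v) (V B u) (V B v) (V C u) (V C v) edge-side)
                         (cong (_∨ E C u v) (sym (B-induced u v)))

  edges-disjoint : E B u v ≡ true → E C u v ≡ true → ⊥
  edges-disjoint uv∈B uv∈C =
    let u∈B , v∈B = B-in-T.edge-ends uv∈B
        u∈C , v∈C = C-in-T.edge-ends uv∈C
    in edge⇒≢ G T-sub (C-in-T.edge⁻ uv∈C) (trans (B∩C⇒root u∈B u∈C) (sym (B∩C⇒root v∈B v∈C)))

  prize-split : prize G r ≡ 0ℚ → prizeOf G T ≡ prizeOf G B + prizeOf G C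
  prize-split p₀ = prizeOf-split {S = T} {X = B} {Y = C} G vertex-cover λ u u∈B u∈C →
    subst (λ z → prize G z ≡ 0ℚ) (sym (B∩C⇒root u∈B u∈C)) p₀

  cost-split : costOf G T ≡ costOf G B + costOf G C
  cost-split = costOf-split {S = T} {X = B} {Y = C} G edge-cover λ _ _ → edges-disjoint

  branch-density : prize G r ≡ 0ℚ → IsMaxDensity G T → density G B ≡ density G T
  branch-density p₀ T-max = summand-density≡ p₀ T-max B-rooted C-rooted (prize-split p₀) cost-split
    (≢-sym (ℚ.<⇒≢ (costOf-pos G (proj₁ (proj₁ B-rooted)) (B-in-T.edge⁺ rw∈T r∈B w∈B))))

  minMax⇒root-neighbour≡w : prize G r ≡ 0ℚ → IsMinMax G T → E T r v ≡ true → v ≡ w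
  minMax⇒root-neighbour≡w {v} p₀ (T-max@(_ , T-best) , minimal) rv with v Fin.≟ w | branch⁻ v v∈B
    where
    B-max : IsMaxDensity G B
    B-max = B-rooted , λ S S-rooted → subst (density G S ≤_) (sym (branch-density p₀ T-max)) (T-best S S-rooted)
    v∈B : V B v ≡ true
    v∈B = proj₂ (B-in-T.edge-ends (trans (proj₂ (minimal B B-max ((λ _ → B⊆T) , λ _ _ → B-in-T.edge⁻)) r v) rv))
  ... | yes v≡w | _               = v≡w
  ... | no _    | inj₁ v≡r        = contradiction (sym v≡r) (edge⇒≢ G T-sub rv)
  ... | no v≢w  | inj₂ (_ , path) =
    contradiction (path+edge⇒cycle path (trans (T-sym v r) rv) (v≢w ∘ sym)) T-acyclic

lemma13 : ∀ {n} (G : Graph n) → prize G (root G) ≡ 0ℚ →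
    (T : Subgraph n) → IsMaxDensity G T →
    ((w : Fin n) (B : Subgraph n) → IsBranch G T w B → density G B ≡ density G T)
    × (IsMinMax G T → (w₁ w₂ : Fin n) →
       E T (root G) w₁ ≡ true → E T (root G) w₂ ≡ true → w₁ ≡ w₂)
lemma13 G p₀ T T-max@(T-rooted , _) =
  (λ w B isBranch → Branch.branch-density T-rooted isBranch p₀ T-max) ,
  λ T-minMax w₁ w₂ rw₁ rw₂ → decidable-stable (w₁ Fin.≟ w₂) λ w₁≢w₂ →
    ¬¬-branch G rw₁ λ (B , isBranch) →
      w₁≢w₂ (sym (Branch.minMax⇒root-neighbour≡w T-rooted isBranch p₀ T-minMax rw₂))
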